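{- Let $G=(V,E)$ be an $n$-vertex graph with a Hamiltonian cycle $C_0=(v_1,\ldots,v_n,v_1)$. (1) If $G$ has a chord of length $\ell$, then $G$ contains a cycle $C'\neq C_0$ of length at least $n-\ell+1$. (2) If $G$ has two crossing chords $e_1,e_2$ with $\mathrm{dist}(e_1,e_2)=d$, then $G$ contains a cycle $C'\neq C_0$ of length at least $n-d+2$. (3) If $G$ has four pairwise independent chords $e_1,e_2,f_1,f_2$ such that $e_1,e_2$ are parallel, $f_1,f_2$ are parallel, $e_i$ and $f_j$ are crossing for every $i,j\in\{1,2\}$, and $\mathrm{dist}(e_1,e_2)=d_1$, $\mathrm{dist}(f_1,f_2)=d_2$, then $G$ contains a cycle $C'\neq C_0$ of length at least $n-d_1-d_2+4$.
   Context: Graphs are finite, simple, undirected; the length of a cycle is its number of edges. A chord is an edge of $G$ not in $C_0$. The length of a chord $v_iv_j$ with $i<j$ is $\min\{j-i,\ n+i-j\}$. Two chords are independent if they share no endpoint. Two independent chords are crossing if their endpoints alternate around $C_0$, and parallel otherwise. For vertices $x,y$, $d(x,y)$ denotes the number of edges of the path from $x$ to $y$ along $C_0$ in the direction $v_1\to v_2\to\cdots\to v_n\to v_1$ (so in general $d(x,y)\neq d(y,x)$). For independent chords $xy$ and $ab$: if they are crossing, labelled so that $a$ lies on the path from $x$ to $y$ around $C_0$, then $\mathrm{dist}(xy,ab)=\min\{d(x,a)+d(y,b),\ d(b,x)+d(a,y)\}$; if they are parallel, labelled so that neither $y$ nor $b$ lies on the path from $x$ to $a$ around $C_0$, then $\mathrm{dist}(xy,ab)=d(x,a)+d(b,y)$.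 -}

module Defs where

open import Data.Nat using (ℕ; zero; suc; _+_; _∸_; _≤_; _⊓_)
open import Data.Nat.DivMod using (_mod_)
open import Data.Fin using (Fin; toℕ)
open import Data.Product using (Σ; ∃; _×_; _,_)
open import Data.Sum using (_⊎_)
open import Relation.Nullary using (¬_)
open import Relation.Binary.PropositionalEquality using (_≡_; _≢_)
open import Function.Definitions using (Injective)
open import Level using (0ℓ)

record Graph (n : ℕ) : Set₁ where
  field
    E     : Fin n → Fin n → Set
    sym   : ∀ {x y} → E x y → E y x
    irrefl : ∀ {x} → ¬ E x x
open Graph public

next : ∀ {k} → Fin k → Fin k
next {suc k} i = suc (toℕ i) mod (suc k)

-- Convention: the Hamiltonian cycle C₀ is (v₁,…,vₙ,v₁) with vᵢ the
-- vertex (i-1) : Fin n, i.e. C₀ = (0,1,…,n-1,0).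
-- G contains C₀ as a Hamiltonian cycle:
HasC0 : ∀ {n} → Graph n → Set
HasC0 {n} G = (i : Fin n) → E G i (next i)

C0Edge : ∀ {n} → Fin n → Fin n → Set
C0Edge x y = (y ≡ next x) ⊎ (x ≡ next y)

Chord : ∀ {n} → Graph n → Fin n → Fin n → Set
Chord G x y = E G x y × ¬ C0Edge x y

-- d(x,y): number of edges of the path from x to y along C₀ in the
-- direction v₁ → v₂ → ⋯ → vₙ → v₁
d : ∀ {n} → Fin n → Fin n → ℕ
d {suc m} x y = toℕ ((toℕ y + suc m ∸ toℕ x) mod (suc m))

chordLength : ∀ {n} → Fin n → Fin n → ℕ
chordLength x y = d x y ⊓ d y x

OnPath : ∀ {n} → Fin n → Fin n → Fin n → Set
OnPath x y z = d x z ≤ d x y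

Independent : ∀ {n} → Fin n → Fin n → Fin n → Fin n → Set
Independent x y a b = x ≢ a × x ≢ b × y ≢ a × y ≢ b

Crossing : ∀ {n} → Fin n → Fin n → Fin n → Fin n → Set
Crossing x y a b =
  Independent x y a b ×
  ((OnPath x y a × OnPath y x b) ⊎ (OnPath y x a × OnPath x y b))

Parallel : ∀ {n} → Fin n → Fin n → Fin n → Fin n → Set
Parallel x y a b = Independent x y a b × ¬ Crossing x y a b

-- dist for crossing chords xy, ab labelled so that a lies on the path x → y
distCrossing : ∀ {n} → Fin n → Fin n → Fin n → Fin n → ℕ
distCrossing x y a b = (d x a + d y b) ⊓ (d b x + d a y)

-- dist for parallel chords xy, ab labelled so that neither y nor b lies
-- on the path x → a
distParallel : ∀ {n} → Fin n → Fin n → Fin n → Fin n → ℕ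
distParallel x y a b = d x a + d b y

record Cycle {n : ℕ} (G : Graph n) : Set where
  field
    len    : ℕ
    len≥3  : 3 ≤ len
    vert   : Fin len → Fin n
    inj    : Injective _≡_ _≡_ vert
    adj    : (i : Fin len) → E G (vert i) (vert (next i))
open Cycle public

CycleEdge : ∀ {n} {G : Graph n} → Cycle G → Fin n → Fin n → Set
CycleEdge C u v = ∃ λ i →
  (vert C i ≡ u × vert C (next i) ≡ v) ⊎ (vert C i ≡ v × vert C (next i) ≡ u)

DistinctFromC0 : ∀ {n} {G : Graph n} → Cycle G → Set
DistinctFromC0 {n} C =
  ¬ (∀ (u v : Fin n) → (CycleEdge C u v → C0Edge u v) × (C0Edge u v → CycleEdge C u v))

-- Measure each vertex by its forward distance from an endpoint of a chord, so that C₀ becomes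
-- the path 0, 1, …, n-1 closed by the edge from n-1 to 0.  A cycle is assembled from pairwise
-- disjoint arcs of this path, consecutive arcs joined by edges of G; it differs from C₀ as soon
-- as its closing edge is a chord.  If the arcs skip gaps of total length g and k chords are used,
-- the cycle has length n - g + k.  In (1) the chord leaves out one of its two arcs; in (2) the
-- crossing chords cut C₀ into four arcs and the two available cycles leave out complementary
-- pairs of them, one pair summing to dist(e₁,e₂); in (3) a cycle through all four chords leaves
-- out exactly the arcs measured by d₁ and d₂.
module Submission where

open import Defs renaming (sym to E-sym)
open import Data.Nat
  using (ℕ; zero; suc; _+_; _∸_; _≤_; _<_; _≰_; _⊓_; z≤n; s≤s; s≤s⁻¹; _≤?_; _<?_; NonZero)
open import Data.Nat.Properties
open import Data.Nat.DivMod using (_%_; _mod_; %-distribˡ-+; m%n%n≡m%n; [m+n]%n≡m%n; m<n⇒m%n≡m; n%n≡0)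
open import Data.Nat.Tactic.RingSolver using (solve-∀)
open import Data.Fin using (Fin; toℕ; fromℕ<)
open import Data.Fin.Properties using (toℕ-fromℕ<; toℕ-injective; toℕ<n)
open import Data.Product using (Σ; _×_; _,_; proj₁; proj₂)
open import Data.Sum using (_⊎_; inj₁; inj₂)
open import Data.Empty using (⊥; ⊥-elim)
open import Data.Unit using (⊤; tt)
open import Data.List using (List; []; _∷_)
open import Data.List.Relation.Unary.All using (All; []; _∷_)
open import Data.List.Relation.Unary.Any using (Any; here; there)
open import Data.List.Relation.Unary.AllPairs using (AllPairs; []; _∷_)
open import Data.List.Relation.Unary.Linked using (Linked; []; [-]; _∷_)
open import Relation.Nullary using (¬_; yes; no)
open import Relation.Binary.Definitions using (tri<; tri≈; tri>)
open import Relation.Binary.PropositionalEquality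

[m%d+n]%d≡[m+n]%d : ∀ m n d .{{_ : NonZero d}} → (m % d + n) % d ≡ (m + n) % d
[m%d+n]%d≡[m+n]%d m n d = begin
  (m % d + n) % d          ≡⟨ %-distribˡ-+ (m % d) n d ⟩
  (m % d % d + n % d) % d  ≡⟨ cong (λ k → (k + n % d) % d) (m%n%n≡m%n m d) ⟩
  (m % d + n % d) % d      ≡⟨ %-distribˡ-+ m n d ⟨
  (m + n) % d              ∎
  where open ≡-Reasoning

[m+n%d]%d≡[m+n]%d : ∀ m n d .{{_ : NonZero d}} → (m + n % d) % d ≡ (m + n) % d
[m+n%d]%d≡[m+n]%d m n d = begin
  (m + n % d) % d  ≡⟨ cong (_% d) (+-comm m (n % d)) ⟩
  (n % d + m) % d  ≡⟨ [m%d+n]%d≡[m+n]%d n m d ⟩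
  (n + m) % d      ≡⟨ cong (_% d) (+-comm n m) ⟩
  (m + n) % d      ∎
  where open ≡-Reasoning

NewCycle : ∀ {n} → Graph n → (ℕ → Set) → Set
NewCycle G P = Σ (Cycle G) λ C → DistinctFromC0 C × P (len C)

module _ {n : ℕ} (G : Graph n) where

  chord⇒≢ : ∀ {u v} → Chord G u v → u ≢ v
  chord⇒≢ {u} (e , _) refl = irrefl G e

  chord-sym : ∀ {u v} → Chord G u v → Chord G v u
  chord-sym (e , ¬c) = E-sym G e , λ c → ¬c (Data.Sum.swap c)

≤-reflexive-+ : ∀ {k ℓ γ μ} → μ ≡ γ → ℓ + γ ≡ k → k ≤ ℓ + μ
≤-reflexive-+ refl eq = ≤-reflexive (sym eq)

module _ {n : ℕ} {G : Graph n} where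

  NewCycle-map : ∀ {P Q : ℕ → Set} → (∀ {ℓ} → P ℓ → Q ℓ) → NewCycle G P → NewCycle G Q
  NewCycle-map f (C , C≢C₀ , p) = C , C≢C₀ , f p

  longer-of : ∀ {k α β} → NewCycle G (λ ℓ → ℓ + α ≡ k) → NewCycle G (λ ℓ → ℓ + β ≡ k) →
              NewCycle G (λ ℓ → k ≤ ℓ + α ⊓ β)
  longer-of {k} {α} {β} Cα Cβ with α ≤? β
  ... | yes α≤β = NewCycle-map (≤-reflexive-+ (m≤n⇒m⊓n≡m α≤β)) Cα
  ... | no  α≰β = NewCycle-map (≤-reflexive-+ (m≥n⇒m⊓n≡n (<⇒≤ (≰⇒> α≰β)))) Cβ

-- Arcs of the path 0, 1, 2, …

data Dir : Set where
  up down : Dir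

-- The positions lo, lo + 1, …, lo + span, visited in increasing (up) or decreasing (down) order.
record Arc : Set where
  constructor arc
  field
    lo   : ℕ
    span : ℕ
    dir  : Dir
open Arc

hi : Arc → ℕ
hi g = lo g + span g

entry exit : Arc → ℕ
entry (arc s t up)   = s
entry (arc s t down) = s + t
exit (arc s t up)   = s + t
exit (arc s t down) = s

at : Arc → ℕ → ℕ
at (arc s t up)   i = s + i
at (arc s t down) i = s + (t ∸ i)

InArc : Arc → ℕ → Set
InArc g k = lo g ≤ k × k ≤ hi g

Disjoint : Arc → Arc → Set
Disjoint g g' = hi g < lo g' ⊎ hi g' < lo g

at-zero : ∀ g → at g 0 ≡ entry g
at-zero (arc s t up)   = +-identityʳ s
at-zero (arc s t down) = refl

at-span : ∀ g → at g (span g) ≡ exit g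
at-span (arc s t up)   = refl
at-span (arc s t down) = trans (cong (s +_) (n∸n≡0 t)) (+-identityʳ s)

at-inArc : ∀ g {i} → i ≤ span g → InArc g (at g i)
at-inArc (arc s t up)   {i} i≤t = m≤m+n s i , +-monoʳ-≤ s i≤t
at-inArc (arc s t down) {i} i≤t = m≤m+n s (t ∸ i) , +-monoʳ-≤ s (m∸n≤m t i)

at-injective : ∀ g {i j} → i ≤ span g → j ≤ span g → at g i ≡ at g j → i ≡ j
at-injective (arc s t up)   _   _   eq = +-cancelˡ-≡ s _ _ eq
at-injective (arc s t down) i≤t j≤t eq = ∸-cancelˡ-≡ i≤t j≤t (+-cancelˡ-≡ s _ _ eq)

disjoint⇒¬both : ∀ {g g' k} → Disjoint g g' → InArc g k → InArc g' k → ⊥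
disjoint⇒¬both (inj₁ lt) (_ , k≤hi) (lo≤k , _) = <⇒≱ lt (≤-trans lo≤k k≤hi)
disjoint⇒¬both (inj₂ lt) (lo≤k , _) (_ , k≤hi) = <⇒≱ lt (≤-trans lo≤k k≤hi)

size : List Arc → ℕ
size []       = 0
size (g ∷ gs) = suc (span g) + size gs

lastArc : Arc → List Arc → Arc
lastArc g []        = g
lastArc g (g' ∷ gs) = lastArc g' gs

-- The i-th position visited (meaningful for i < size gs).
trace : List Arc → ℕ → ℕ
trace []       i = 0
trace (g ∷ gs) i with i ≤? span g
... | yes _ = at g i
... | no  _ = trace gs (i ∸ suc (span g))

module _ (g : Arc) (gs : List Arc) where

  trace-head : ∀ {i} → i ≤ span g → trace (g ∷ gs) i ≡ at g i
  trace-head {i} i≤ with i ≤? span g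
  ... | yes _ = refl
  ... | no  ≰ = ⊥-elim (≰ i≤)

  trace-tail : ∀ {i} → span g < i → trace (g ∷ gs) i ≡ trace gs (i ∸ suc (span g))
  trace-tail {i} lt with i ≤? span g
  ... | yes ≤ = ⊥-elim (<⇒≱ lt ≤)
  ... | no  _ = refl

  tail-index< : ∀ {i} → span g < i → i < size (g ∷ gs) → i ∸ suc (span g) < size gs
  tail-index< {i} lt i< =
    +-cancelˡ-< (suc (span g)) _ _ (subst (_< size (g ∷ gs)) (sym (m+[n∸m]≡n lt)) i<)

  trace-zero : trace (g ∷ gs) 0 ≡ entry g
  trace-zero = trans (trace-head z≤n) (at-zero g)

trace-last : ∀ g gs → trace (g ∷ gs) (span g + size gs) ≡ exit (lastArc g gs)
trace-last g [] = begin
  trace (g ∷ []) (span g + 0)  ≡⟨ cong (trace (g ∷ [])) (+-identityʳ (span g)) ⟩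
  trace (g ∷ []) (span g)      ≡⟨ trace-head g [] ≤-refl ⟩
  at g (span g)                ≡⟨ at-span g ⟩
  exit g                       ∎
  where open ≡-Reasoning
trace-last g (g' ∷ gs) = begin
  trace (g ∷ g' ∷ gs) (span g + size (g' ∷ gs))  ≡⟨ trace-tail g (g' ∷ gs) span<i ⟩
  trace (g' ∷ gs) (span g + size (g' ∷ gs) ∸ suc (span g))
    ≡⟨ cong (trace (g' ∷ gs)) (trans (cong (_∸ suc (span g)) (+-suc (span g) _)) (m+n∸m≡n (span g) _)) ⟩
  trace (g' ∷ gs) (span g' + size gs)            ≡⟨ trace-last g' gs ⟩
  exit (lastArc g' gs)                           ∎
  where
  open ≡-Reasoning
  span<i : span g < span g + size (g' ∷ gs)
  span<i = subst (span g <_) (sym (+-suc (span g) _)) (s≤s (m≤m+n (span g) _))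

trace-inArc : ∀ gs {i} → i < size gs → Any (λ g → InArc g (trace gs i)) gs
trace-inArc (g ∷ gs) {i} i< with i ≤? span g
... | yes i≤ = here (at-inArc g i≤)
... | no  i≰ = there (trace-inArc gs (tail-index< g gs (≰⇒> i≰) i<))

inArc-separated : ∀ {g gs k} → All (Disjoint g) gs → Any (λ g' → InArc g' k) gs → ¬ InArc g k
inArc-separated {g} {g' ∷ _} (g#g' ∷ _) (here k∈g') k∈g = disjoint⇒¬both {g} {g'} g#g' k∈g k∈g'
inArc-separated {g} {_ ∷ _} (_ ∷ g#gs) (there k∈gs) k∈g = inArc-separated {g} g#gs k∈gs k∈g

trace-injective : ∀ gs {i j} → AllPairs Disjoint gs → i < size gs → j < size gs →
                  trace gs i ≡ trace gs j → i ≡ j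
trace-injective (g ∷ gs) {i} {j} (g#gs ∷ gs#) i< j< eq with i ≤? span g | j ≤? span g
... | yes i≤ | yes j≤ = at-injective g i≤ j≤ eq
... | yes i≤ | no  j≰ =
  ⊥-elim (inArc-separated {g} g#gs (trace-inArc gs {j ∸ suc (span g)} (tail-index< g gs (≰⇒> j≰) j<))
                                   (subst (InArc g) eq (at-inArc g i≤)))
... | no  i≰ | yes j≤ =
  ⊥-elim (inArc-separated {g} g#gs (trace-inArc gs {i ∸ suc (span g)} (tail-index< g gs (≰⇒> i≰) i<))
                                   (subst (InArc g) (sym eq) (at-inArc g j≤)))
... | no  i≰ | no  j≰ =
  ∸-cancelʳ-≡ (≰⇒> i≰) (≰⇒> j≰)
    (trace-injective gs gs# (tail-index< g gs (≰⇒> i≰) i<) (tail-index< g gs (≰⇒> j≰) j<) eq)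

-- The five arcs [z₁,z₂], [z₇,m], [0,0], [z₅,z₆], [z₃,z₄] and the four gaps between them cover 0, …, m.
five-arcs+gaps : ∀ {m z₁ z₂ z₃ z₄ z₅ z₆ z₇} →
  z₁ ≤ z₂ → z₂ ≤ z₃ → z₃ ≤ z₄ → z₄ ≤ z₅ → z₅ ≤ z₆ → z₆ ≤ z₇ → z₇ ≤ m →
  suc (z₂ ∸ z₁) + (suc (m ∸ z₇) + (1 + (suc (z₆ ∸ z₅) + (suc (z₄ ∸ z₃) + 0))))
    + (z₁ + (z₅ ∸ z₄)) + ((z₃ ∸ z₂) + (z₇ ∸ z₆)) ≡ suc m + 4
five-arcs+gaps {z₁ = z₁} l₁ l₂ l₃ l₄ l₅ l₆ l₇
  with m≤n⇒∃[o]m+o≡n l₁ | m≤n⇒∃[o]m+o≡n l₂ | m≤n⇒∃[o]m+o≡n l₃ | m≤n⇒∃[o]m+o≡n l₄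
     | m≤n⇒∃[o]m+o≡n l₅ | m≤n⇒∃[o]m+o≡n l₆ | m≤n⇒∃[o]m+o≡n l₇
... | g₁ , refl | g₂ , refl | g₃ , refl | g₄ , refl | g₅ , refl | g₆ , refl | g₇ , refl
  rewrite m+n∸m≡n z₁ g₁ | m+n∸m≡n (z₁ + g₁) g₂ | m+n∸m≡n (z₁ + g₁ + g₂) g₃
        | m+n∸m≡n (z₁ + g₁ + g₂ + g₃) g₄ | m+n∸m≡n (z₁ + g₁ + g₂ + g₃ + g₄) g₅
        | m+n∸m≡n (z₁ + g₁ + g₂ + g₃ + g₄ + g₅) g₆ | m+n∸m≡n (z₁ + g₁ + g₂ + g₃ + g₄ + g₅ + g₆) g₇
  = gaps z₁ g₁ g₂ g₃ g₄ g₅ g₆ g₇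
  where
  gaps : ∀ z₁ g₁ g₂ g₃ g₄ g₅ g₆ g₇ →
    suc g₁ + (suc g₇ + (1 + (suc g₅ + (suc g₃ + 0)))) + (z₁ + g₄) + (g₂ + g₆)
      ≡ suc (z₁ + g₁ + g₂ + g₃ + g₄ + g₅ + g₆ + g₇) + 4
  gaps = solve-∀

-- Positions along C₀

toℕ-next : ∀ {k} (i : Fin (suc k)) → toℕ (next i) ≡ suc (toℕ i) % suc k
toℕ-next i = toℕ-fromℕ< _

module _ {m : ℕ} where
  private
    N : ℕ
    N = suc m

  advance : Fin N → ℕ → Fin N
  advance o k = (toℕ o + k) mod N

  toℕ-advance : ∀ o k → toℕ (advance o k) ≡ (toℕ o + k) % N
  toℕ-advance o k = toℕ-fromℕ< _

  d≡% : ∀ (o v : Fin N) → d o v ≡ (toℕ v + N ∸ toℕ o) % N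
  d≡% o v = toℕ-fromℕ< _

  d<N : ∀ (o v : Fin N) → d o v < N
  d<N o v = toℕ<n _

  next-advance : ∀ o k → next (advance o k) ≡ advance o (suc k)
  next-advance o k = toℕ-injective (begin
    toℕ (next (advance o k))     ≡⟨ toℕ-next (advance o k) ⟩
    suc (toℕ (advance o k)) % N  ≡⟨ cong (λ i → suc i % N) (toℕ-advance o k) ⟩
    (1 + (toℕ o + k) % N) % N    ≡⟨ [m+n%d]%d≡[m+n]%d 1 (toℕ o + k) N ⟩
    suc (toℕ o + k) % N          ≡⟨ cong (_% N) (+-suc (toℕ o) k) ⟨
    (toℕ o + suc k) % N          ≡⟨ toℕ-advance o (suc k) ⟨
    toℕ (advance o (suc k))      ∎)
    where open ≡-Reasoning

  advance-+ : ∀ o i k → advance (advance o i) k ≡ advance o (i + k)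
  advance-+ o i k = toℕ-injective (begin
    toℕ (advance (advance o i) k)  ≡⟨ toℕ-advance (advance o i) k ⟩
    (toℕ (advance o i) + k) % N    ≡⟨ cong (λ j → (j + k) % N) (toℕ-advance o i) ⟩
    ((toℕ o + i) % N + k) % N      ≡⟨ [m%d+n]%d≡[m+n]%d (toℕ o + i) k N ⟩
    (toℕ o + i + k) % N            ≡⟨ cong (_% N) (+-assoc (toℕ o) i k) ⟩
    (toℕ o + (i + k)) % N          ≡⟨ toℕ-advance o (i + k) ⟨
    toℕ (advance o (i + k))        ∎)
    where open ≡-Reasoning

  advance-+N : ∀ o k → advance o (k + N) ≡ advance o k
  advance-+N o k = toℕ-injective (begin
    toℕ (advance o (k + N))  ≡⟨ toℕ-advance o (k + N) ⟩
    (toℕ o + (k + N)) % N    ≡⟨ cong (_% N) (+-assoc (toℕ o) k N) ⟨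
    (toℕ o + k + N) % N      ≡⟨ [m+n]%n≡m%n (toℕ o + k) N ⟩
    (toℕ o + k) % N          ≡⟨ toℕ-advance o k ⟨
    toℕ (advance o k)        ∎)
    where open ≡-Reasoning

  advance-zero : ∀ o → advance o 0 ≡ o
  advance-zero o = toℕ-injective (begin
    toℕ (advance o 0)  ≡⟨ toℕ-advance o 0 ⟩
    (toℕ o + 0) % N    ≡⟨ cong (_% N) (+-identityʳ (toℕ o)) ⟩
    toℕ o % N          ≡⟨ m<n⇒m%n≡m (toℕ<n o) ⟩
    toℕ o              ∎)
    where open ≡-Reasoning

  advance-d : ∀ o v → advance o (d o v) ≡ v
  advance-d o v = toℕ-injective (begin
    toℕ (advance o (d o v))                   ≡⟨ toℕ-advance o (d o v) ⟩
    (toℕ o + d o v) % N                       ≡⟨ cong (λ k → (toℕ o + k) % N) (d≡% o v) ⟩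
    (toℕ o + (toℕ v + N ∸ toℕ o) % N) % N     ≡⟨ [m+n%d]%d≡[m+n]%d (toℕ o) _ N ⟩
    (toℕ o + (toℕ v + N ∸ toℕ o)) % N         ≡⟨ cong (_% N) (m+[n∸m]≡n o≤v+N) ⟩
    (toℕ v + N) % N                           ≡⟨ [m+n]%n≡m%n (toℕ v) N ⟩
    toℕ v % N                                 ≡⟨ m<n⇒m%n≡m (toℕ<n v) ⟩
    toℕ v                                     ∎)
    where
    open ≡-Reasoning
    o≤v+N : toℕ o ≤ toℕ v + N
    o≤v+N = ≤-trans (<⇒≤ (toℕ<n o)) (m≤n+m N (toℕ v))

  d-advance : ∀ o {k} → k < N → d o (advance o k) ≡ k
  d-advance o {k} k<N = begin
    d o (advance o k)                            ≡⟨ d≡% o (advance o k) ⟩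
    (toℕ (advance o k) + N ∸ toℕ o) % N          ≡⟨ cong (λ j → (j + N ∸ toℕ o) % N) (toℕ-advance o k) ⟩
    ((toℕ o + k) % N + N ∸ toℕ o) % N            ≡⟨ cong (_% N) (+-∸-assoc ((toℕ o + k) % N) o≤N) ⟩
    ((toℕ o + k) % N + (N ∸ toℕ o)) % N          ≡⟨ [m%d+n]%d≡[m+n]%d (toℕ o + k) _ N ⟩
    (toℕ o + k + (N ∸ toℕ o)) % N                ≡⟨ cong (_% N) (+-comm (toℕ o + k) (N ∸ toℕ o)) ⟩
    ((N ∸ toℕ o) + (toℕ o + k)) % N              ≡⟨ cong (_% N) (+-assoc (N ∸ toℕ o) (toℕ o) k) ⟨
    ((N ∸ toℕ o) + toℕ o + k) % N                ≡⟨ cong (λ j → (j + k) % N) (m∸n+n≡m o≤N) ⟩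
    (N + k) % N                                  ≡⟨ cong (_% N) (+-comm N k) ⟩
    (k + N) % N                                  ≡⟨ [m+n]%n≡m%n k N ⟩
    k % N                                        ≡⟨ m<n⇒m%n≡m k<N ⟩
    k                                            ∎
    where
    open ≡-Reasoning
    o≤N : toℕ o ≤ N
    o≤N = <⇒≤ (toℕ<n o)

  advance-injective : ∀ o {i j} → i < N → j < N → advance o i ≡ advance o j → i ≡ j
  advance-injective o i<N j<N eq = trans (sym (d-advance o i<N)) (trans (cong (d o) eq) (d-advance o j<N))

  d-injective : ∀ o {u v} → d o u ≡ d o v → u ≡ v
  d-injective o {u} {v} eq = trans (sym (advance-d o u)) (trans (cong (advance o) eq) (advance-d o v))

  d-self : ∀ o → d o o ≡ 0
  d-self o = trans (cong (d o) (sym (advance-zero o))) (d-advance o (s≤s z≤n))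

  advance-d+d : ∀ o u v → advance o (d o u + d u v) ≡ v
  advance-d+d o u v = begin
    advance o (d o u + d u v)            ≡⟨ advance-+ o (d o u) (d u v) ⟨
    advance (advance o (d o u)) (d u v)  ≡⟨ cong (λ w → advance w (d u v)) (advance-d o u) ⟩
    advance u (d u v)                    ≡⟨ advance-d u v ⟩
    v                                    ∎
    where open ≡-Reasoning

  d-triangle : ∀ o u v → d o u + d u v ≡ d o v ⊎ d o u + d u v ≡ d o v + N
  d-triangle o u v with d o u + d u v <? N
  ... | yes s<N = inj₁ (advance-injective o s<N (d<N o v) (trans (advance-d+d o u v) (sym (advance-d o v))))
  ... | no  s≮N = inj₂ (trans (sym (m∸n+n≡m N≤s)) (cong (_+ N) (advance-injective o s∸N<N (d<N o v) lands-on-v)))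
    where
    N≤s : N ≤ d o u + d u v
    N≤s = ≮⇒≥ s≮N
    s∸N<N : d o u + d u v ∸ N < N
    s∸N<N = +-cancelʳ-< N _ N (subst (_< N + N) (sym (m∸n+n≡m N≤s)) (+-mono-< (d<N o u) (d<N u v)))
    lands-on-v : advance o (d o u + d u v ∸ N) ≡ advance o (d o v)
    lands-on-v = begin
      advance o (d o u + d u v ∸ N)      ≡⟨ advance-+N o _ ⟨
      advance o (d o u + d u v ∸ N + N)  ≡⟨ cong (advance o) (m∸n+n≡m N≤s) ⟩
      advance o (d o u + d u v)          ≡⟨ advance-d+d o u v ⟩
      v                                  ≡⟨ advance-d o v ⟨
      advance o (d o v)                  ∎
      where open ≡-Reasoning

  d+d≡N : ∀ {u v} → u ≢ v → d u v + d v u ≡ N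
  d+d≡N {u} {v} u≢v with d-triangle u v u
  ... | inj₁ eq = ⊥-elim (u≢v (sym (d-injective u (trans duv≡0 (sym (d-self u))))))
    where duv≡0 = m+n≡0⇒m≡0 (d u v) (trans eq (d-self u))
  ... | inj₂ eq = trans eq (cong (_+ N) (d-self u))

  module Around (o : Fin N) where

    D : Fin N → ℕ
    D = d o

    D<N : ∀ v → D v < N
    D<N = d<N o

    D-origin≤ : ∀ u → D o ≤ D u
    D-origin≤ u = subst (_≤ D u) (sym (d-self o)) z≤n

    D-< : ∀ {u v} → D u ≤ D v → u ≢ v → D u < D v
    D-< le u≢v = ≤∧≢⇒< le (λ eq → u≢v (d-injective o eq))

    0<D : ∀ {v} → o ≢ v → 0 < D v
    0<D {v} o≢v = subst (_< D v) (d-self o) (D-< (D-origin≤ v) o≢v)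

    D≰D-origin : ∀ {v} → o ≢ v → D v ≰ D o
    D≰D-origin o≢v le = o≢v (d-injective o (≤-antisym (D-origin≤ _) le))

    D+d≡D : ∀ u v → D u ≤ D v → D u + d u v ≡ D v
    D+d≡D u v u≤v with d-triangle o u v
    ... | inj₁ eq = eq
    ... | inj₂ eq = ⊥-elim (<-irrefl eq (+-mono-≤-< u≤v (d<N u v)))

    D+d≡D+N : ∀ u v → D v < D u → D u + d u v ≡ D v + N
    D+d≡D+N u v v<u with d-triangle o u v
    ... | inj₁ eq = ⊥-elim (<⇒≱ v<u (subst (D u ≤_) eq (m≤m+n (D u) (d u v))))
    ... | inj₂ eq = eq

    d≡D∸D : ∀ u v → D u ≤ D v → d u v ≡ D v ∸ D u
    d≡D∸D u v u≤v = trans (sym (m+n∸m≡n (D u) (d u v))) (cong (_∸ D u) (D+d≡D u v u≤v))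

    Ascending : List (Fin N) → Set
    Ascending = Linked (λ u v → D u < D v)

    module _ {u v w : Fin N} where

      onPath⇒between : D u ≤ D v → OnPath u v w → D u ≤ D w × D w ≤ D v
      onPath⇒between u≤v w∈ with D u ≤? D w
      ... | yes u≤w = u≤w , subst₂ _≤_ (D+d≡D u w u≤w) (D+d≡D u v u≤v) (+-monoʳ-≤ (D u) w∈)
      ... | no  u≰w = ⊥-elim (<⇒≱ (D<N v) (begin
        N            ≤⟨ m≤n+m N (D w) ⟩
        D w + N      ≡⟨ D+d≡D+N u w (≰⇒> u≰w) ⟨
        D u + d u w  ≤⟨ +-monoʳ-≤ (D u) w∈ ⟩
        D u + d u v  ≡⟨ D+d≡D u v u≤v ⟩
        D v          ∎))
        where open ≤-Reasoning

      onPath⇒outside : D v < D u → OnPath u v w → D u ≤ D w ⊎ D w ≤ D v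
      onPath⇒outside v<u w∈ with D u ≤? D w
      ... | yes u≤w = inj₁ u≤w
      ... | no  u≰w = inj₂ (+-cancelʳ-≤ N _ _
            (subst₂ _≤_ (D+d≡D+N u w (≰⇒> u≰w)) (D+d≡D+N u v v<u) (+-monoʳ-≤ (D u) w∈)))

      between⇒onPath : D u ≤ D w → D w ≤ D v → OnPath u v w
      between⇒onPath u≤w w≤v = +-cancelˡ-≤ (D u) _ _
        (subst₂ _≤_ (sym (D+d≡D u w u≤w)) (sym (D+d≡D u v (≤-trans u≤w w≤v))) w≤v)

      above⇒onPath : D v < D u → D u ≤ D w → OnPath u v w
      above⇒onPath v<u u≤w = +-cancelˡ-≤ (D u) _ _
        (subst₂ _≤_ (sym (D+d≡D u w u≤w)) (sym (D+d≡D+N u v v<u)) (≤-trans (<⇒≤ (D<N w)) (m≤n+m N (D v))))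

      below⇒onPath : D v < D u → D w ≤ D v → OnPath u v w
      below⇒onPath v<u w≤v = +-cancelˡ-≤ (D u) _ _
        (subst₂ _≤_ (sym (D+d≡D+N u w (≤-<-trans w≤v v<u))) (sym (D+d≡D+N u v v<u)) (+-monoˡ-≤ N w≤v))

      ¬onPath⇒outside : D u ≤ D v → ¬ OnPath u v w → D w < D u ⊎ D v < D w
      ¬onPath⇒outside u≤v w∉ with D u ≤? D w | D w ≤? D v
      ... | no  u≰w | _       = inj₁ (≰⇒> u≰w)
      ... | yes _   | no  w≰v = inj₂ (≰⇒> w≰v)
      ... | yes u≤w | yes w≤v = ⊥-elim (w∉ (between⇒onPath u≤w w≤v))

      ¬onPath⇒between : D v < D u → ¬ OnPath u v w → D v < D w × D w < D u
      ¬onPath⇒between v<u w∉ with D u ≤? D w | D w ≤? D v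
      ... | yes u≤w | _       = ⊥-elim (w∉ (above⇒onPath v<u u≤w))
      ... | no  _   | yes w≤v = ⊥-elim (w∉ (below⇒onPath v<u w≤v))
      ... | no  u≰w | no  w≰v = ≰⇒> w≰v , ≰⇒> u≰w

    strictly-between : ∀ {a b w} → a ≢ w → b ≢ w → D a ≤ D w × D w ≤ D b → D a < D w × D w < D b
    strictly-between a≢w b≢w (a≤w , w≤b) = D-< a≤w a≢w , D-< w≤b (λ eq → b≢w (sym eq))

    beyond : ∀ {y w} → o ≢ y → o ≢ w → y ≢ w → OnPath y o w → D y < D w
    beyond o≢y o≢w y≢w w∈ with onPath⇒outside (D-< (D-origin≤ _) o≢y) w∈
    ... | inj₁ y≤w = D-< y≤w y≢w
    ... | inj₂ w≤o = ⊥-elim (D≰D-origin o≢w w≤o)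

    crossing-origin : ∀ {y u v} → o ≢ y → Crossing o y u v →
                      (D u < D y × D y < D v) ⊎ (D v < D y × D y < D u)
    crossing-origin o≢y ((o≢u , o≢v , y≢u , y≢v) , inj₁ (u∈ , v∈)) =
      inj₁ (proj₂ (strictly-between o≢u y≢u (onPath⇒between (D-origin≤ _) u∈)) , beyond o≢y o≢v y≢v v∈)
    crossing-origin o≢y ((o≢u , o≢v , y≢u , y≢v) , inj₂ (u∈ , v∈)) =
      inj₂ (proj₂ (strictly-between o≢v y≢v (onPath⇒between (D-origin≤ _) v∈)) , beyond o≢y o≢u y≢u u∈)

    crossing-inside : ∀ {a b u v} → D a < D b → Crossing a b u v →
                      (D a < D u × D u < D b) ⊎ (D a < D v × D v < D b)
    crossing-inside a<b ((a≢u , a≢v , b≢u , b≢v) , inj₁ (u∈ , _)) =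
      inj₁ (strictly-between a≢u b≢u (onPath⇒between (<⇒≤ a<b) u∈))
    crossing-inside a<b ((a≢u , a≢v , b≢u , b≢v) , inj₂ (_ , v∈)) =
      inj₂ (strictly-between a≢v b≢v (onPath⇒between (<⇒≤ a<b) v∈))

    Spans : Fin N → Fin N → Fin N → Fin N → Fin N → Set
    Spans a b y u v = D a < D u × D u < D b × D y < D v

    crossing-both : ∀ {y a b u v} → o ≢ y → D a < D b → D b < D y →
                    Crossing o y u v → Crossing a b u v → Spans a b y u v ⊎ Spans a b y v u
    crossing-both o≢y a<b b<y oy×uv ab×uv with crossing-origin o≢y oy×uv | crossing-inside a<b ab×uv
    ... | inj₁ (_ , y<v) | inj₁ (a<u , u<b) = inj₁ (a<u , u<b , y<v)
    ... | inj₁ (_ , y<v) | inj₂ (_ , v<b)   = ⊥-elim (<-asym y<v (<-trans v<b b<y))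
    ... | inj₂ (_ , y<u) | inj₁ (_ , u<b)   = ⊥-elim (<-asym y<u (<-trans u<b b<y))
    ... | inj₂ (_ , y<u) | inj₂ (a<v , v<b) = inj₂ (a<v , v<b , y<u)

    parallel-origin : ∀ {y a b} → Parallel o y a b → ¬ OnPath o a y → ¬ OnPath o a b →
                      0 < D a × D a < D b × D b < D y
    parallel-origin {y} {a} {b} (oy·ab@(o≢a , _) , ¬crossing) y∉ b∉ = 0<D o≢a , a<b , b<y
      where
      beyond-a : ∀ {w} → ¬ OnPath o a w → D a < D w
      beyond-a w∉ with ¬onPath⇒outside (D-origin≤ a) w∉
      ... | inj₁ w<o = ⊥-elim (<⇒≱ w<o (D-origin≤ _))
      ... | inj₂ a<w = a<w
      a<y = beyond-a y∉
      a<b = beyond-a b∉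
      b<y : D b < D y
      b<y with D y ≤? D b
      ... | no  y≰b = ≰⇒> y≰b
      ... | yes y≤b = ⊥-elim (¬crossing (oy·ab , inj₁ (between⇒onPath (D-origin≤ a) (<⇒≤ a<y) ,
                                                      above⇒onPath (≤-<-trans (D-origin≤ a) a<y) y≤b)))

    module _ {a b y p q r s : Fin N} (b<y : D b < D y) (pq∥rs : Parallel p q r s)
             (q∉pr : ¬ OnPath p r q) (s∉pr : ¬ OnPath p r s) where

      private
        uncrossed : OnPath p q r → ¬ OnPath q p s
        uncrossed r∈ s∈ = proj₂ pq∥rs (proj₁ pq∥rs , inj₁ (r∈ , s∈))

      parallel-order : Spans a b y p q ⊎ Spans a b y q p → Spans a b y r s ⊎ Spans a b y s r →
                       Ascending (a ∷ p ∷ r ∷ b ∷ y ∷ s ∷ q ∷ []) ⊎ Ascending (a ∷ s ∷ q ∷ b ∷ y ∷ p ∷ r ∷ [])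
      parallel-order (inj₁ (a<p , p<b , y<q)) (inj₁ (a<r , r<b , y<s)) =
        inj₁ (a<p ∷ p<r ∷ r<b ∷ b<y ∷ y<s ∷ s<q ∷ [-])
        where
        p<q = <-trans (<-trans p<b b<y) y<q
        p<r : D p < D r
        p<r with D p ≤? D r
        ... | yes p≤r = D-< p≤r (proj₁ (proj₁ pq∥rs))
        ... | no  p≰r = ⊥-elim (<-asym p<q (proj₂ (¬onPath⇒between (≰⇒> p≰r) q∉pr)))
        s<q : D s < D q
        s<q with D q ≤? D s
        ... | no  q≰s = ≰⇒> q≰s
        ... | yes q≤s = ⊥-elim (uncrossed (between⇒onPath (<⇒≤ p<r) (<⇒≤ (<-trans (<-trans r<b b<y) y<q)))
                                          (above⇒onPath p<q q≤s))
      parallel-order (inj₁ (a<p , p<b , y<q)) (inj₂ (a<s , s<b , y<r)) =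
        ⊥-elim (uncrossed (between⇒onPath (<⇒≤ p<r) (<⇒≤ r<q)) (below⇒onPath p<q (<⇒≤ s<p)))
        where
        p<q = <-trans (<-trans p<b b<y) y<q
        p<r = <-trans (<-trans p<b b<y) y<r
        r<q : D r < D q
        r<q with ¬onPath⇒outside (<⇒≤ p<r) q∉pr
        ... | inj₁ q<p = ⊥-elim (<-asym p<q q<p)
        ... | inj₂ r<q = r<q
        s<p : D s < D p
        s<p with ¬onPath⇒outside (<⇒≤ p<r) s∉pr
        ... | inj₁ s<p = s<p
        ... | inj₂ r<s = ⊥-elim (<-asym r<s (<-trans (<-trans s<b b<y) y<r))
      parallel-order (inj₂ (a<q , q<b , y<p)) (inj₁ (a<r , r<b , y<s)) =
        ⊥-elim (uncrossed (below⇒onPath q<p (<⇒≤ (proj₁ q∈rp)))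
                          (between⇒onPath (<⇒≤ (<-trans (<-trans q<b b<y) y<s)) (<⇒≤ (proj₂ s∈rp))))
        where
        q<p = <-trans (<-trans q<b b<y) y<p
        r<p = <-trans (<-trans r<b b<y) y<p
        q∈rp = ¬onPath⇒between r<p q∉pr
        s∈rp = ¬onPath⇒between r<p s∉pr
      parallel-order (inj₂ (a<q , q<b , y<p)) (inj₂ (a<s , s<b , y<r)) =
        inj₂ (a<s ∷ s<q ∷ q<b ∷ b<y ∷ y<p ∷ p<r ∷ [-])
        where
        q<p = <-trans (<-trans q<b b<y) y<p
        p<r : D p < D r
        p<r with D p ≤? D r
        ... | yes p≤r = D-< p≤r (proj₁ (proj₁ pq∥rs))
        ... | no  p≰r = ⊥-elim (<-asym (proj₁ (¬onPath⇒between (≰⇒> p≰r) q∉pr)) (<-trans (<-trans q<b b<y) y<r))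
        s<q : D s < D q
        s<q with D q ≤? D s
        ... | no  q≰s = ≰⇒> q≰s
        ... | yes q≤s = ⊥-elim (uncrossed (above⇒onPath q<p (<⇒≤ p<r))
                                          (between⇒onPath q≤s (<⇒≤ (<-trans (<-trans s<b b<y) y<p))))

    around : ∀ {u v w} → D u ≤ D v → D v ≤ D w → D o < D w → D u + d u v + d v w + d w o ≡ N
    around {u} {v} {w} u≤v v≤w o<w = begin
      D u + d u v + d v w + d w o  ≡⟨ cong (λ k → k + d v w + d w o) (D+d≡D u v u≤v) ⟩
      D v + d v w + d w o          ≡⟨ cong (_+ d w o) (D+d≡D v w v≤w) ⟩
      D w + d w o                  ≡⟨ D+d≡D+N w o o<w ⟩
      D o + N                      ≡⟨ cong (_+ N) (d-self o) ⟩
      N                            ∎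
      where open ≡-Reasoning

    rotate : ∀ {u v w} → 0 < D u → D u < D v → D v < D w → 0 < d u v × d u v < d u w × d u w < d u o
    rotate {u} {v} {w} 0<u u<v v<w =
      subst (0 <_) (sym uv) (m<n⇒0<n∸m u<v) ,
      subst₂ _<_ (sym uv) (sym uw) (∸-monoˡ-< v<w (<⇒≤ u<v)) ,
      subst₂ _<_ (sym uw) (sym uo) (∸-monoˡ-< (<-≤-trans (D<N w) (m≤n+m N (D o))) (<⇒≤ u<w))
      where
      u<w = <-trans u<v v<w
      uv = d≡D∸D u v (<⇒≤ u<v)
      uw = d≡D∸D u w (<⇒≤ u<w)
      uo : d u o ≡ D o + N ∸ D u
      uo = trans (sym (m+n∸m≡n (D u) (d u o)))
                 (cong (_∸ D u) (D+d≡D+N u o (subst (_< D u) (sym (d-self o)) 0<u)))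

  module ArcCycles (G : Graph N) (c0 : HasC0 G) (o : Fin N) where

    Adj : ℕ → ℕ → Set
    Adj i j = E G (advance o i) (advance o j)

    Joined : List Arc → Set
    Joined []            = ⊤
    Joined (g ∷ [])      = ⊤
    Joined (g ∷ g' ∷ gs) = Adj (exit g) (entry g') × Joined (g' ∷ gs)

    adj-suc : ∀ k → Adj k (suc k)
    adj-suc k = subst (E G (advance o k)) (next-advance o k) (c0 (advance o k))

    adj-along : ∀ g {i} → i < span g → Adj (at g i) (at g (suc i))
    adj-along (arc s t up)   {i} _   = subst (Adj (s + i)) (sym (+-suc s i)) (adj-suc (s + i))
    adj-along (arc s t down) {i} i<t =
      subst (λ k → Adj k (s + (t ∸ suc i))) (sym (trans (cong (s +_) (+-∸-assoc 1 i<t)) (+-suc s _)))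
        (E-sym G (adj-suc (s + (t ∸ suc i))))

    adj-trace : ∀ gs → Joined gs → ∀ {i} → suc i < size gs → Adj (trace gs i) (trace gs (suc i))
    adj-trace (g ∷ gs) joined {i} i+1< with <-cmp i (span g)
    adj-trace (g ∷ gs) joined {i} i+1< | tri< i<t _ _ =
      subst₂ Adj (sym (trace-head g gs (<⇒≤ i<t))) (sym (trace-head g gs i<t)) (adj-along g i<t)
    adj-trace (g ∷ []) joined {i} i+1< | tri≈ _ refl _ =
      ⊥-elim (<-irrefl refl (subst (suc i <_) (+-identityʳ (suc i)) i+1<))
    adj-trace (g ∷ g' ∷ gs) (link , _) {i} i+1< | tri≈ _ refl _ =
      subst₂ Adj (sym (trans (trace-head g (g' ∷ gs) ≤-refl) (at-span g)))
                 (sym (trans (trace-tail g (g' ∷ gs) ≤-refl)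
                             (trans (cong (trace (g' ∷ gs)) (n∸n≡0 (suc i))) (trace-zero g' gs))))
                 link
    adj-trace (g ∷ []) joined {i} i+1< | tri> _ _ t<i =
      ⊥-elim (<⇒≱ t<i (<⇒≤ (s≤s⁻¹ (subst (suc i <_) (+-identityʳ (suc (span g))) i+1<))))
    adj-trace (g ∷ g' ∷ gs) (_ , joined) {i} i+1< | tri> _ _ t<i =
      subst₂ Adj (sym (trace-tail g (g' ∷ gs) t<i))
                 (sym (trans (trace-tail g (g' ∷ gs) (<-trans t<i (n<1+n i))) (cong (trace (g' ∷ gs)) shift)))
                 (adj-trace (g' ∷ gs) joined (subst (_< size (g' ∷ gs)) shift
                   (tail-index< g (g' ∷ gs) (<-trans t<i (n<1+n i)) i+1<)))
      where
      shift : suc i ∸ suc (span g) ≡ suc (i ∸ suc (span g))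
      shift = +-∸-assoc 1 t<i

    trace<N : ∀ gs → All (λ g → hi g < N) gs → ∀ {i} → i < size gs → trace gs i < N
    trace<N gs hi<N i< = bound hi<N (trace-inArc gs i<)
      where
      bound : ∀ {gs k} → All (λ g → hi g < N) gs → Any (λ g → InArc g k) gs → k < N
      bound (hi<N ∷ _) (here (_ , k≤hi)) = ≤-<-trans k≤hi hi<N
      bound (_ ∷ hi<N) (there k∈)      = bound hi<N k∈

    arcCycle : ∀ g gs → All (λ g → hi g < N) (g ∷ gs) → AllPairs Disjoint (g ∷ gs) → Joined (g ∷ gs) →
               Chord G (advance o (exit (lastArc g gs))) (advance o (entry g)) → 3 ≤ size (g ∷ gs) →
               NewCycle G (_≡ size (g ∷ gs))
    arcCycle g gs hi<N disjoint joined closing 3≤size = C , C≢C₀ , refl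
      where
      L = size (g ∷ gs)

      vertex : Fin L → Fin N
      vertex i = advance o (trace (g ∷ gs) (toℕ i))

      vertex-injective : ∀ {i j} → vertex i ≡ vertex j → i ≡ j
      vertex-injective {i} {j} eq = toℕ-injective (trace-injective (g ∷ gs) disjoint (toℕ<n i) (toℕ<n j)
        (advance-injective o (trace<N (g ∷ gs) hi<N (toℕ<n i)) (trace<N (g ∷ gs) hi<N (toℕ<n j)) eq))

      closes : ∀ (i : Fin L) → suc (toℕ i) ≡ L →
               vertex i ≡ advance o (exit (lastArc g gs)) × vertex (next i) ≡ advance o (entry g)
      closes i i+1≡L =
        cong (advance o) (trans (cong (trace (g ∷ gs)) (suc-injective i+1≡L)) (trace-last g gs)) ,
        cong (advance o) (trans (cong (trace (g ∷ gs)) next≡0) (trace-zero g gs))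
        where
        next≡0 : toℕ (next i) ≡ 0
        next≡0 = trans (toℕ-next i) (trans (cong (_% L) i+1≡L) (n%n≡0 L))

      adjacent : ∀ (i : Fin L) → E G (vertex i) (vertex (next i))
      adjacent i with suc (toℕ i) <? L
      ... | yes i+1<L = subst (λ k → Adj (trace (g ∷ gs) (toℕ i)) (trace (g ∷ gs) k))
                              (sym (trans (toℕ-next i) (m<n⇒m%n≡m i+1<L))) (adj-trace (g ∷ gs) joined i+1<L)
      ... | no  i+1≮L = subst₂ (E G) (sym (proj₁ ends)) (sym (proj₂ ends)) (proj₁ closing)
        where ends = closes i (≤-antisym (toℕ<n i) (≮⇒≥ i+1≮L))

      C : Cycle G
      C = record { len = L ; len≥3 = 3≤size ; vert = vertex ; inj = vertex-injective ; adj = adjacent }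

      -- The closing edge of C is a chord, so it is not an edge of C₀.
      C≢C₀ : DistinctFromC0 C
      C≢C₀ same = proj₂ closing (subst₂ C0Edge (proj₁ ends) (proj₂ ends)
                                  (proj₁ (same (vertex i) (vertex (next i))) (i , inj₁ (refl , refl))))
        where
        i = fromℕ< (n<1+n (span g + size gs))
        ends = closes i (cong suc (toℕ-fromℕ< (n<1+n (span g + size gs))))

    relabel : ∀ (R : Fin N → Fin N → Set) {u v} → R u v → R (advance o (d o u)) (advance o (d o v))
    relabel R = subst₂ R (sym (advance-d o _)) (sym (advance-d o _))

    relabel-to-origin : ∀ (R : Fin N → Fin N → Set) {u} → R u o → R (advance o (d o u)) (advance o 0)
    relabel-to-origin R = subst₂ R (sym (advance-d o _)) (sym (advance-zero o))

    relabel-from-origin : ∀ (R : Fin N → Fin N → Set) {v} → R o v → R (advance o 0) (advance o (d o v))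
    relabel-from-origin R = subst₂ R (sym (advance-zero o)) (sym (advance-d o _))

    oneArcCycle : ∀ {k} → 2 ≤ k → k < N → Chord G (advance o k) (advance o 0) → NewCycle G (_≡ suc k)
    oneArcCycle {k} 2≤k k<N closing =
      NewCycle-map (λ eq → trans eq (cong suc (+-identityʳ k)))
        (arcCycle (arc 0 k up) [] (k<N ∷ []) ([] ∷ []) tt closing (s≤s (≤-trans 2≤k (m≤m+n k 0))))

    twoArcCycle : ∀ {i j k} → 0 < i → i < j → j < k → k < N →
                  Adj i k → Chord G (advance o j) (advance o 0) → NewCycle G (_≡ 2 + (i + (k ∸ j)))
    twoArcCycle {i} {j} {k} 0<i i<j j<k k<N link closing =
      NewCycle-map (λ eq → trans eq (size≡ i (k ∸ j)))
        (arcCycle (arc 0 i up) (arc j (k ∸ j) down ∷ [])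
          (<-trans i<j (<-trans j<k k<N) ∷ subst (_< N) (sym j+[k∸j]≡k) k<N ∷ [])
          ((inj₁ i<j ∷ []) ∷ [] ∷ [])
          (subst (Adj i) (sym j+[k∸j]≡k) link , tt)
          closing
          (s≤s (+-mono-≤ 0<i (s≤s z≤n))))
      where
      j+[k∸j]≡k = m+[n∸m]≡n (<⇒≤ j<k)
      size≡ : ∀ a b → suc a + (suc b + 0) ≡ 2 + (a + b)
      size≡ = solve-∀

    fiveArcCycle : ∀ {z₁ z₂ z₃ z₄ z₅ z₆ z₇} →
      0 < z₁ → z₁ < z₂ → z₂ < z₃ → z₃ < z₄ → z₄ < z₅ → z₅ < z₆ → z₆ < z₇ → z₇ < N →
      Adj z₂ z₇ → Adj 0 z₅ → Adj z₆ z₃ → Chord G (advance o z₄) (advance o z₁) →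
      NewCycle G (λ ℓ → ℓ + (z₁ + (z₅ ∸ z₄)) + ((z₃ ∸ z₂) + (z₇ ∸ z₆)) ≡ N + 4)
    fiveArcCycle {z₁} {z₂} {z₃} {z₄} {z₅} {z₆} {z₇} l₀ l₁ l₂ l₃ l₄ l₅ l₆ l₇ e₂₇ e₀₅ e₆₃ closing =
      NewCycle-map (λ eq → trans (cong (λ ℓ → ℓ + _ + _) eq)
                                 (five-arcs+gaps (<⇒≤ l₁) (<⇒≤ l₂) (<⇒≤ l₃) (<⇒≤ l₄) (<⇒≤ l₅) (<⇒≤ l₆) z₇≤m))
        (arcCycle g₁ (g₂ ∷ g₃ ∷ g₄ ∷ g₅ ∷ []) hi<N disjoint joined
          (subst (λ k → Chord G (advance o k) (advance o z₁)) (sym hi₅) closing)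
          (s≤s (≤-trans (s≤s (≤-trans (s≤s z≤n) (m≤n+m _ (m ∸ z₇)))) (m≤n+m _ (z₂ ∸ z₁)))))
      where
      z₇≤m = s≤s⁻¹ l₇
      g₁ = arc z₁ (z₂ ∸ z₁) up
      g₂ = arc z₇ (m ∸ z₇) up
      g₃ = arc 0 0 up
      g₄ = arc z₅ (z₆ ∸ z₅) up
      g₅ = arc z₃ (z₄ ∸ z₃) up
      hi₁ = m+[n∸m]≡n (<⇒≤ l₁)
      hi₂ = m+[n∸m]≡n z₇≤m
      hi₄ = m+[n∸m]≡n (<⇒≤ l₅)
      hi₅ = m+[n∸m]≡n (<⇒≤ l₃)
      l₂₃ = <-trans l₂ l₃
      l₂₅ = <-trans l₂₃ l₄
      l₂₇ = <-trans (<-trans l₂₅ l₅) l₆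
      l₄₇ = <-trans l₄ (<-trans l₅ l₆)
      l₀₃ = <-trans (<-trans l₀ l₁) l₂
      l₀₅ = <-trans (<-trans l₀₃ l₃) l₄
      l₀₇ = <-trans (<-trans l₀₅ l₅) l₆

      hi<N : All (λ g → hi g < N) (g₁ ∷ g₂ ∷ g₃ ∷ g₄ ∷ g₅ ∷ [])
      hi<N = subst (_< N) (sym hi₁) (<-trans l₂₇ l₇) ∷ subst (_< N) (sym hi₂) ≤-refl ∷ s≤s z≤n
           ∷ subst (_< N) (sym hi₄) (<-trans l₆ l₇) ∷ subst (_< N) (sym hi₅) (<-trans l₄₇ l₇) ∷ []

      disjoint : AllPairs Disjoint (g₁ ∷ g₂ ∷ g₃ ∷ g₄ ∷ g₅ ∷ [])
      disjoint = (inj₁ (subst (_< z₇) (sym hi₁) l₂₇) ∷ inj₂ l₀ ∷ inj₁ (subst (_< z₅) (sym hi₁) l₂₅)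
                   ∷ inj₁ (subst (_< z₃) (sym hi₁) l₂) ∷ [])
               ∷ (inj₂ l₀₇ ∷ inj₂ (subst (_< z₇) (sym hi₄) l₆) ∷ inj₂ (subst (_< z₇) (sym hi₅) l₄₇) ∷ [])
               ∷ (inj₁ l₀₅ ∷ inj₁ l₀₃ ∷ [])
               ∷ (inj₂ (subst (_< z₅) (sym hi₅) l₄) ∷ [])
               ∷ [] ∷ []

      joined : Joined (g₁ ∷ g₂ ∷ g₃ ∷ g₄ ∷ g₅ ∷ [])
      joined = subst (λ k → Adj k z₇) (sym hi₁) e₂₇
             , subst₂ Adj (sym hi₂) refl (subst (E G (advance o m)) (advance-+N o 0) (adj-suc m))
             , e₀₅
             , subst (λ k → Adj k z₃) (sym hi₄) e₆₃
             , tt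

  module _ (G : Graph N) (c0 : HasC0 G) where

    2≤d : ∀ {x y} → Chord G x y → 2 ≤ d y x
    2≤d {x} {y} xy with d y x in eq
    ... | zero        = ⊥-elim (chord⇒≢ G xy (d-injective y (trans eq (sym (d-self y)))))
    ... | suc (suc _) = s≤s (s≤s z≤n)
    ... | suc zero    = ⊥-elim (proj₂ xy (inj₂ (begin
      x                   ≡⟨ advance-d y x ⟨
      advance y (d y x)   ≡⟨ cong (advance y) eq ⟩
      advance y 1         ≡⟨ next-advance y 0 ⟨
      next (advance y 0)  ≡⟨ cong next (advance-zero y) ⟩
      next y              ∎)))
      where open ≡-Reasoning

    chordCycle : ∀ {x y} → Chord G x y → NewCycle G (λ ℓ → ℓ + d x y ≡ N + 1)
    chordCycle {x} {y} xy =
      NewCycle-map (λ {ℓ} eq → begin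
          ℓ + d x y            ≡⟨ cong (_+ d x y) eq ⟩
          suc (d y x + d x y)  ≡⟨ cong suc (d+d≡N (chord⇒≢ G (chord-sym G xy))) ⟩
          suc N                ≡⟨ +-comm 1 N ⟩
          N + 1                ∎)
        (oneArcCycle (2≤d xy) (d<N y x) (relabel-to-origin (Chord G) xy))
      where
      open ArcCycles G c0 y
      open ≡-Reasoning

    crossingCycle : ∀ o {a y b} → 0 < d o a → d o a < d o y → d o y < d o b → E G a b → Chord G y o →
                    NewCycle G (_≡ 2 + (d o a + d y b))
    crossingCycle o {a} {y} {b} 0<a a<y y<b ab yo =
      NewCycle-map (λ eq → trans eq (cong (λ k → 2 + (d o a + k)) (sym (d≡D∸D y b (<⇒≤ y<b)))))
        (twoArcCycle 0<a a<y y<b (D<N b) (relabel (E G) ab) (relabel-to-origin (Chord G) yo))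
      where
      open ArcCycles G c0 o
      open Around o

    fiveChordCycle : ∀ o {w₁ w₂ w₃ w₄ w₅ w₆ w₇} →
      0 < d o w₁ → Around.Ascending o (w₁ ∷ w₂ ∷ w₃ ∷ w₄ ∷ w₅ ∷ w₆ ∷ w₇ ∷ []) →
      E G w₂ w₇ → E G o w₅ → E G w₆ w₃ → Chord G w₄ w₁ →
      NewCycle G (λ ℓ → ℓ + (d o w₁ + d w₄ w₅) + (d w₂ w₃ + d w₆ w₇) ≡ N + 4)
    fiveChordCycle o {w₁} {w₂} {w₃} {w₄} {w₅} {w₆} {w₇} 0<w₁ (l₁ ∷ l₂ ∷ l₃ ∷ l₄ ∷ l₅ ∷ l₆ ∷ [-])
                   e₂₇ e₀₅ e₆₃ closing =
      NewCycle-map (λ {ℓ} eq → trans (cong₂ (λ k k' → ℓ + (d o w₁ + k) + k') (gap l₄)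
                                            (cong₂ _+_ (gap l₂) (gap l₆))) eq)
        (fiveArcCycle 0<w₁ l₁ l₂ l₃ l₄ l₅ l₆ (D<N w₇)
          (relabel (E G) e₂₇) (relabel-from-origin (E G) e₀₅) (relabel (E G) e₆₃)
          (relabel (Chord G) closing))
      where
      open ArcCycles G c0 o
      open Around o
      gap : ∀ {u v} → D u < D v → d u v ≡ D v ∸ D u
      gap {u} {v} u<v = d≡D∸D u v (<⇒≤ u<v)

    long-cycle-from-chord : ∀ x y → Chord G x y → NewCycle G (λ ℓ → N + 1 ≤ ℓ + chordLength x y)
    long-cycle-from-chord x y xy = longer-of (chordCycle xy) (chordCycle (chord-sym G xy))

    module _ (x : Fin N) where
      open Around x

      long-cycle-from-crossing-chords : ∀ y a b → Chord G x y → Chord G a b →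
        Crossing x y a b → OnPath x y a → NewCycle G (λ ℓ → N + 2 ≤ ℓ + distCrossing x y a b)
      long-cycle-from-crossing-chords y a b xy ab xy×ab a∈xy with crossing-origin (chord⇒≢ G xy) xy×ab
      ... | inj₂ (_ , y<a) = ⊥-elim (<⇒≱ y<a (proj₂ (onPath⇒between (D-origin≤ y) a∈xy)))
      ... | inj₁ (a<y , y<b) = longer-of C₁ C₂
        where
        0<a = 0<D (proj₁ (proj₁ xy×ab))
        from-a = rotate 0<a a<y y<b
        total : d x a + d a y + d y b + d b x ≡ N
        total = around (<⇒≤ a<y) (<⇒≤ y<b) (≤-<-trans (D-origin≤ y) y<b)
        shuffle₁ : ∀ α β γ δ → 2 + (β + δ) + (α + γ) ≡ α + β + γ + δ + 2
        shuffle₁ = solve-∀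
        shuffle₂ : ∀ α β γ δ → 2 + (α + γ) + (δ + β) ≡ α + β + γ + δ + 2
        shuffle₂ = solve-∀
        C₁ : NewCycle G (λ ℓ → ℓ + (d x a + d y b) ≡ N + 2)
        C₁ = NewCycle-map
          (λ eq → trans (cong (_+ (d x a + d y b)) eq)
                        (trans (shuffle₁ (d x a) (d a y) (d y b) (d b x)) (cong (_+ 2) total)))
          (crossingCycle a (proj₁ from-a) (proj₁ (proj₂ from-a)) (proj₂ (proj₂ from-a))
            (E-sym G (proj₁ xy)) (chord-sym G ab))
        C₂ : NewCycle G (λ ℓ → ℓ + (d b x + d a y) ≡ N + 2)
        C₂ = NewCycle-map
          (λ eq → trans (cong (_+ (d b x + d a y)) eq)
                        (trans (shuffle₂ (d x a) (d a y) (d y b) (d b x)) (cong (_+ 2) total)))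
          (crossingCycle x 0<a a<y y<b (proj₁ ab) (chord-sym G xy))

      long-cycle-from-parallel-pairs : ∀ y a b p q r s →
        Chord G x y → Chord G a b → Chord G p q → Chord G r s →
        Parallel x y a b → ¬ OnPath x a y → ¬ OnPath x a b →
        Parallel p q r s → ¬ OnPath p r q → ¬ OnPath p r s →
        Crossing x y p q → Crossing x y r s → Crossing a b p q → Crossing a b r s →
        NewCycle G (λ ℓ → N + 4 ≤ ℓ + distParallel x y a b + distParallel p q r s)
      long-cycle-from-parallel-pairs y a b p q r s xy ab pq rs
                                     xy∥ab y∉xa b∉xa pq∥rs q∉pr s∉pr xy×pq xy×rs ab×pq ab×rs
        with parallel-origin xy∥ab y∉xa b∉xa
      ... | 0<a , a<b , b<y
        with parallel-order b<y pq∥rs q∉pr s∉pr (crossing-both (chord⇒≢ G xy) a<b b<y xy×pq ab×pq)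
                                                (crossing-both (chord⇒≢ G xy) a<b b<y xy×rs ab×rs)
      ... | inj₁ a<p<r<b<y<s<q =
        NewCycle-map (λ eq → ≤-reflexive (sym eq))
          (fiveChordCycle x 0<a a<p<r<b<y<s<q (proj₁ pq) (proj₁ xy) (E-sym G (proj₁ rs)) (chord-sym G ab))
      ... | inj₂ a<s<q<b<y<p<r =
        NewCycle-map (λ {ℓ} eq → ≤-reflexive (sym (trans (cong (ℓ + distParallel x y a b +_)
                                                               (+-comm (d p r) (d s q))) eq)))
          (fiveChordCycle x 0<a a<s<q<b<y<p<r (E-sym G (proj₁ rs)) (proj₁ xy) (proj₁ pq) (chord-sym G ab))

-- The six Independent hypotheses of (3) are already part of the Parallel and Crossing ones.
lemma5 : ∀ {n : ℕ} (G : Graph n) → 3 ≤ n → HasC0 G →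
    -- (1)
    ((x y : Fin n) → Chord G x y →
      Σ (Cycle G) λ C → DistinctFromC0 C × n + 1 ≤ len C + chordLength x y)
  × -- (2)
    ((x y a b : Fin n) → Chord G x y → Chord G a b →
      Crossing x y a b → OnPath x y a →
      Σ (Cycle G) λ C → DistinctFromC0 C × n + 2 ≤ len C + distCrossing x y a b)
  × -- (3)
    ((x y a b p q r s : Fin n) →
      Chord G x y → Chord G a b → Chord G p q → Chord G r s →
      Independent x y a b → Independent x y p q → Independent x y r s →
      Independent a b p q → Independent a b r s → Independent p q r s →
      Parallel x y a b → ¬ OnPath x a y → ¬ OnPath x a b →
      Parallel p q r s → ¬ OnPath p r q → ¬ OnPath p r s →
      Crossing x y p q → Crossing x y r s → Crossing a b p q → Crossing a b r s →
      Σ (Cycle G) λ C → DistinctFromC0 C ×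
        n + 4 ≤ len C + distParallel x y a b + distParallel p q r s)
lemma5 {suc m} G (s≤s _) c0 =
  long-cycle-from-chord G c0 ,
  (λ x → long-cycle-from-crossing-chords G c0 x) ,
  λ x y a b p q r s xy ab pq rs _ _ _ _ _ _ → long-cycle-from-parallel-pairs G c0 x y a b p q r s xy ab pq rs
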